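{- Let $G_S=(S,N,E_S)$ be a bipartite graph with no isolated vertices, let $\gamma=|N|$, and suppose the maximum degree is $\Delta$. Then there is a subset $S'\subseteq S$ with $|\Gamma^1_S(S')|\geq\gamma/\Delta$.
   Context: For $S'\subseteq S$, $\Gamma^1_S(S')$ is the set of vertices outside $S$ (i.e. in $N$) that have exactly one neighbor in $S'$. -}

module Defs where

open import Data.Nat using (ℕ; _≡ᵇ_)
open import Data.Bool using (Bool; _∧_)
open import Data.Fin using (Fin)
open import Data.Fin.Subset using (Subset; ∣_∣)
open import Data.Vec using (tabulate; lookup)

-- A bipartite graph G_S = (S, N, E_S) with S = Fin s, N = Fin n,
-- given by its (decidable) bipartite adjacency E i j = true iff i ∈ S adjacent to j ∈ N.
BipGraph : ℕ → ℕ → Set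
BipGraph s n = Fin s → Fin n → Bool

degS : ∀ {s n} → BipGraph s n → Fin s → ℕ
degS E i = ∣ tabulate (E i) ∣

degN : ∀ {s n} → BipGraph s n → Fin n → ℕ
degN E j = ∣ tabulate (λ i → E i j) ∣

degIn : ∀ {s n} → BipGraph s n → Subset s → Fin n → ℕ
degIn E S' j = ∣ tabulate (λ i → lookup S' i ∧ E i j) ∣

Γ¹ : ∀ {s n} → BipGraph s n → Subset s → Subset n
Γ¹ E S' = tabulate (λ j → degIn E S' j ≡ᵇ 1)

module Submission where

-- Call P ⊆ S a cover if every j ∈ N has a neighbour in P, and
-- irredundant if every i ∈ P has a private neighbour, i.e. some j ∈ N
-- whose only neighbour in P is i.  Since N has no isolated vertex, S is a
-- cover, and deleting vertices of a cover one at a time for as long as the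
-- result stays a cover ends in an irredundant cover P.  Both bounds then
-- come from one weighted double-counting identity (`handshake`):
--   * P is a cover and degrees in S are ≤ Δ, so  |N| ≤ Σ_j deg_P(j) ≤ Δ·|P|;
--   * counting pairs (i, j) with i ∈ P and j ∈ Γ¹(P) a neighbour of i,
--     each i ∈ P has at least one (its private neighbour) and each
--     j ∈ Γ¹(P) lies in exactly one, so |P| ≤ |Γ¹(P)|.

open import Defs
open import Data.Nat using (ℕ; zero; suc; _+_; _*_; _≤_; z≤n; s≤s; _≡ᵇ_; _≤?_)
open import Data.Nat.Properties
open import Algebra.Properties.CommutativeSemigroup +-commutativeSemigroup using (x∙yz≈y∙xz)
open import Algebra.Properties.Semiring.Sum +-*-semiring
  using (sum; sum-syntax; sum-cong-≗; ∑-comm; *-distribˡ-sum; *-distribʳ-sum)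
open import Data.Fin using (Fin; zero; suc)
open import Data.Fin.Properties using (any?; all?; ¬∀⟶∃¬)
open import Data.Fin.Subset using (∣_∣)
open import Data.Bool using (Bool; true; false; _∧_)
import Data.Bool.Properties as Bool
open import Data.Vec using (tabulate; lookup)
open import Data.Vec.Properties using (lookup∘tabulate)
open import Data.Vec.Functional using (updateAt)
open import Data.Sum using (_⊎_)
open import Data.Product using (∃-syntax; _×_; _,_)
open import Relation.Nullary using (¬_; Dec; yes; no; contradiction)
open import Relation.Nullary.Decidable using (_×-dec_)
open import Relation.Binary.PropositionalEquality
  using (_≡_; refl; sym; trans; cong; module ≡-Reasoning)
open import Function using (_∘_)

⟦_⟧ : Bool → ℕ
⟦ true ⟧ = 1
⟦ false ⟧ = 0

⟦∧⟧ : ∀ a b → ⟦ a ∧ b ⟧ ≡ ⟦ a ⟧ * ⟦ b ⟧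
⟦∧⟧ true b = sym (+-identityʳ ⟦ b ⟧)
⟦∧⟧ false b = refl

∑-mono-≤ : ∀ {k} {f g : Fin k → ℕ} → (∀ x → f x ≤ g x) → sum f ≤ sum g
∑-mono-≤ {zero} _ = z≤n
∑-mono-≤ {suc k} f≤g = +-mono-≤ (f≤g zero) (∑-mono-≤ (f≤g ∘ suc))

∑-term : ∀ {k} (f : Fin k → ℕ) x → f x ≤ sum f
∑-term f zero = m≤m+n (f zero) _
∑-term f (suc x) = ≤-trans (∑-term (f ∘ suc) x) (m≤n+m _ (f zero))

∑-ones : ∀ k → ∑[ _ < k ] 1 ≡ k
∑-ones zero = refl
∑-ones (suc k) = cong suc (∑-ones k)

count : ∀ {k} → (Fin k → Bool) → ℕ
count {k} P = ∑[ x < k ] ⟦ P x ⟧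

∣tabulate∣≡count : ∀ {k} (P : Fin k → Bool) → ∣ tabulate P ∣ ≡ count P
∣tabulate∣≡count {zero} P = refl
∣tabulate∣≡count {suc k} P with P zero
... | true = cong suc (∣tabulate∣≡count (P ∘ suc))
... | false = ∣tabulate∣≡count (P ∘ suc)

_─_ : ∀ {k} → (Fin k → Bool) → Fin k → Fin k → Bool
P ─ i = updateAt P i (λ _ → false)

count-─ : ∀ {k} (P Q : Fin k → Bool) i → P i ≡ true →
          count (λ x → P x ∧ Q x) ≡ ⟦ Q i ⟧ + count (λ x → (P ─ i) x ∧ Q x)
count-─ P Q zero Pi rewrite Pi = refl
count-─ {suc k} P Q (suc i) Pi = begin
    ⟦ P zero ∧ Q zero ⟧ + count (λ x → P (suc x) ∧ Q (suc x))
  ≡⟨ cong (⟦ P zero ∧ Q zero ⟧ +_) (count-─ (P ∘ suc) (Q ∘ suc) i Pi) ⟩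
    ⟦ P zero ∧ Q zero ⟧ + (⟦ Q (suc i) ⟧ + count (λ x → ((P ∘ suc) ─ i) x ∧ Q (suc x)))
  ≡⟨ x∙yz≈y∙xz ⟦ P zero ∧ Q zero ⟧ ⟦ Q (suc i) ⟧ _ ⟩
    ⟦ Q (suc i) ⟧ + (⟦ P zero ∧ Q zero ⟧ + count (λ x → ((P ∘ suc) ─ i) x ∧ Q (suc x)))
  ∎
  where open ≡-Reasoning

count-─-suc : ∀ {k} (P : Fin k → Bool) i → P i ≡ true → count P ≡ suc (count (P ─ i))
count-─-suc P i Pi = begin
  count P                              ≡⟨ sum-cong-≗ (cong ⟦_⟧ ∘ sym ∘ Bool.∧-identityʳ ∘ P) ⟩
  count (λ x → P x ∧ true)             ≡⟨ count-─ P (λ _ → true) i Pi ⟩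
  suc (count (λ x → (P ─ i) x ∧ true)) ≡⟨ cong suc (sum-cong-≗ (cong ⟦_⟧ ∘ Bool.∧-identityʳ ∘ (P ─ i))) ⟩
  suc (count (P ─ i))                  ∎
  where open ≡-Reasoning

module _ {s n : ℕ} (E : BipGraph s n) where

  deg : (Fin s → Bool) → Fin n → ℕ
  deg P j = count (λ i → P i ∧ E i j)

  Covers : (Fin s → Bool) → Set
  Covers P = ∀ j → 1 ≤ deg P j

  covers? : ∀ P → Dec (Covers P)
  covers? P = all? (λ j → 1 ≤? deg P j)

  Irredundant : (Fin s → Bool) → Set
  Irredundant P = ∀ i → P i ≡ true → ∃[ j ] (E i j ≡ true × deg P j ≡ 1)

  deg-after-─ : ∀ P i j → P i ≡ true → ¬ 1 ≤ deg (P ─ i) j → deg P j ≡ ⟦ E i j ⟧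
  deg-after-─ P i j Pi uncovered = begin
    deg P j                     ≡⟨ count-─ P (λ x → E x j) i Pi ⟩
    ⟦ E i j ⟧ + deg (P ─ i) j   ≡⟨ cong (⟦ E i j ⟧ +_) (n<1⇒n≡0 (≰⇒> uncovered)) ⟩
    ⟦ E i j ⟧ + 0               ≡⟨ +-identityʳ _ ⟩
    ⟦ E i j ⟧                   ∎
    where open ≡-Reasoning

  -- A cover from which no member can be deleted is irredundant: a vertex
  -- j left uncovered by P ─ i has i as its unique neighbour in P.
  minimal⇒irredundant : ∀ P → Covers P →
                        (∀ i → P i ≡ true → ¬ Covers (P ─ i)) → Irredundant P
  minimal⇒irredundant P cover minimal i Pi
    with ¬∀⟶∃¬ n _ (λ j → 1 ≤? deg (P ─ i) j) (minimal i Pi)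
  ... | j , uncovered with E i j in Eij
  ...   | true  = j , Eij , trans (deg-after-─ P i j Pi uncovered) (cong ⟦_⟧ Eij)
  ...   | false = contradiction (≤-trans (cover j) (≤-reflexive
                    (trans (deg-after-─ P i j Pi uncovered) (cong ⟦_⟧ Eij)))) λ ()

  -- Every cover contains an irredundant cover: greedily delete members
  -- whose removal keeps a cover.  The count of P bounds the recursion.
  irredundant-subcover : ∀ P → Covers P → ∃[ P' ] (Covers P' × Irredundant P')
  irredundant-subcover P = prune (count P) P ≤-refl
    where
    prune : ∀ k P → count P ≤ k → Covers P → ∃[ P' ] (Covers P' × Irredundant P')
    prune k P size cover with any? (λ i → (P i Bool.≟ true) ×-dec covers? (P ─ i))
    ... | no minimal = P , cover , minimal⇒irredundant P cover (λ i Pi c → minimal (i , Pi , c))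
    ... | yes (i , Pi , cover') with k | ≤-trans (≤-reflexive (sym (count-─-suc P i Pi))) size
    ...   | suc k' | s≤s size' = prune k' (P ─ i) size' cover'

  handshake : ∀ P (w : Fin n → ℕ) →
              ∑[ j < n ] (deg P j * w j) ≡ ∑[ i < s ] (⟦ P i ⟧ * ∑[ j < n ] (⟦ E i j ⟧ * w j))
  handshake P w = begin
      ∑[ j < n ] (deg P j * w j)
    ≡⟨ sum-cong-≗ {n} (λ j → *-distribʳ-sum (w j) (λ i → ⟦ P i ∧ E i j ⟧)) ⟩
      ∑[ j < n ] ∑[ i < s ] (⟦ P i ∧ E i j ⟧ * w j)
    ≡⟨ sum-cong-≗ {n} (λ j → sum-cong-≗ {s} (λ i → edge i j)) ⟩
      ∑[ j < n ] ∑[ i < s ] (⟦ P i ⟧ * (⟦ E i j ⟧ * w j))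
    ≡⟨ ∑-comm (λ j i → ⟦ P i ⟧ * (⟦ E i j ⟧ * w j)) ⟩
      ∑[ i < s ] ∑[ j < n ] (⟦ P i ⟧ * (⟦ E i j ⟧ * w j))
    ≡⟨ sum-cong-≗ {s} (λ i → sym (*-distribˡ-sum ⟦ P i ⟧ (λ j → ⟦ E i j ⟧ * w j))) ⟩
      ∑[ i < s ] (⟦ P i ⟧ * ∑[ j < n ] (⟦ E i j ⟧ * w j))
    ∎
    where
    open ≡-Reasoning
    edge : ∀ i j → ⟦ P i ∧ E i j ⟧ * w j ≡ ⟦ P i ⟧ * (⟦ E i j ⟧ * w j)
    edge i j = trans (cong (_* w j) (⟦∧⟧ (P i) (E i j))) (*-assoc ⟦ P i ⟧ _ _)

  cover-bound : ∀ Δ P → (∀ i → degS E i ≤ Δ) → Covers P → n ≤ Δ * count P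
  cover-bound Δ P deg≤Δ cover = begin
    n                                                   ≡⟨ sym (∑-ones n) ⟩
    ∑[ j < n ] 1                                        ≤⟨ ∑-mono-≤ (λ j → ≤-trans (cover j) (≤-reflexive (sym (*-identityʳ _)))) ⟩
    ∑[ j < n ] (deg P j * 1)                            ≡⟨ handshake P (λ _ → 1) ⟩
    ∑[ i < s ] (⟦ P i ⟧ * ∑[ j < n ] (⟦ E i j ⟧ * 1))   ≤⟨ ∑-mono-≤ (λ i → *-monoʳ-≤ ⟦ P i ⟧ (degree≤Δ i)) ⟩
    ∑[ i < s ] (⟦ P i ⟧ * Δ)                            ≡⟨ sym (*-distribʳ-sum Δ (⟦_⟧ ∘ P)) ⟩
    count P * Δ                                         ≡⟨ *-comm (count P) Δ ⟩
    Δ * count P                                         ∎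
    where
    open ≤-Reasoning
    degree≤Δ : ∀ i → ∑[ j < n ] (⟦ E i j ⟧ * 1) ≤ Δ
    degree≤Δ i = begin
      ∑[ j < n ] (⟦ E i j ⟧ * 1)  ≡⟨ sum-cong-≗ {n} (λ j → *-identityʳ ⟦ E i j ⟧) ⟩
      count (E i)                 ≡⟨ sym (∣tabulate∣≡count (E i)) ⟩
      degS E i                    ≤⟨ deg≤Δ i ⟩
      Δ                           ∎

  unique : (Fin s → Bool) → Fin n → Bool
  unique P j = deg P j ≡ᵇ 1

  -- An irredundant P is no larger than Γ¹(P): weight j by [j ∈ Γ¹(P)];
  -- each i ∈ P sees weight ≥ 1 (a private neighbour), each j ∈ Γ¹(P) is
  -- seen by exactly one member of P.
  private-bound : ∀ P → Irredundant P → count P ≤ count (unique P)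
  private-bound P irredundant = begin
    ∑[ i < s ] ⟦ P i ⟧                                            ≤⟨ ∑-mono-≤ has-private ⟩
    ∑[ i < s ] (⟦ P i ⟧ * ∑[ j < n ] (⟦ E i j ⟧ * ⟦ unique P j ⟧))  ≡⟨ sym (handshake P (⟦_⟧ ∘ unique P)) ⟩
    ∑[ j < n ] (deg P j * ⟦ unique P j ⟧)                          ≡⟨ sum-cong-≗ {n} (λ j → m*⟦m≡ᵇ1⟧ (deg P j)) ⟩
    count (unique P)                                              ∎
    where
    open ≤-Reasoning
    m*⟦m≡ᵇ1⟧ : ∀ m → m * ⟦ m ≡ᵇ 1 ⟧ ≡ ⟦ m ≡ᵇ 1 ⟧
    m*⟦m≡ᵇ1⟧ zero = refl
    m*⟦m≡ᵇ1⟧ (suc zero) = refl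
    m*⟦m≡ᵇ1⟧ (suc (suc m)) = *-zeroʳ (suc (suc m))
    has-private : ∀ i → ⟦ P i ⟧ ≤ ⟦ P i ⟧ * ∑[ j < n ] (⟦ E i j ⟧ * ⟦ unique P j ⟧)
    has-private i with P i in Pi
    ... | false = z≤n
    ... | true with irredundant i Pi
    ...   | j , Eij , degj = ≤-trans (≤-reflexive private-term)
                               (≤-trans (∑-term (λ j → ⟦ E i j ⟧ * ⟦ unique P j ⟧) j)
                                        (≤-reflexive (sym (+-identityʳ _))))
      where
      private-term : 1 ≡ ⟦ E i j ⟧ * ⟦ unique P j ⟧
      private-term rewrite Eij | degj = refl

  degIn-tabulate : ∀ P j → degIn E (tabulate P) j ≡ deg P j
  degIn-tabulate P j = trans (∣tabulate∣≡count (λ i → lookup (tabulate P) i ∧ E i j))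
    (sum-cong-≗ {s} (λ i → cong (λ b → ⟦ b ∧ E i j ⟧) (lookup∘tabulate P i)))

  ∣Γ¹∣≡count : ∀ P → ∣ Γ¹ E (tabulate P) ∣ ≡ count (unique P)
  ∣Γ¹∣≡count P = trans (∣tabulate∣≡count (λ j → degIn E (tabulate P) j ≡ᵇ 1))
    (sum-cong-≗ {n} (λ j → cong (λ m → ⟦ m ≡ᵇ 1 ⟧) (degIn-tabulate P j)))

lemmaA1 : (s n : ℕ) (E : BipGraph s n) (Δ : ℕ)
    → (∀ i → 1 ≤ degS E i)
    → (∀ j → 1 ≤ degN E j)
    → (∀ i → degS E i ≤ Δ)
    → (∀ j → degN E j ≤ Δ)
    → ((∃[ i ] degS E i ≡ Δ) ⊎ (∃[ j ] degN E j ≡ Δ))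
    → ∃[ S' ] n ≤ Δ * ∣ Γ¹ E S' ∣
lemmaA1 s n E Δ _ noIsolatedN degS≤Δ _ _
  with irredundant-subcover E (λ _ → true) S-covers
  where
  S-covers : Covers E (λ _ → true)
  S-covers j = ≤-trans (noIsolatedN j) (≤-reflexive (∣tabulate∣≡count (λ i → E i j)))
... | P , cover , irredundant = tabulate P , (begin
  n                          ≤⟨ cover-bound E Δ P degS≤Δ cover ⟩
  Δ * count P                ≤⟨ *-monoʳ-≤ Δ (private-bound E P irredundant) ⟩
  Δ * count (unique E P)     ≡⟨ cong (Δ *_) (sym (∣Γ¹∣≡count E P)) ⟩
  Δ * ∣ Γ¹ E (tabulate P) ∣  ∎)
  where open ≤-Reasoning
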